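{- Let $n\ge 1$ and let $t_1,\dots,t_n$ be nonnegative integers. Then $P'(t_1,t_2,\ldots,t_n)$ is odd if and only if, for every bit position $x\ge 0$, the number of indices $i$ such that the binary representation of $t_i$ has digit $1$ in position $x$ is even.
   Context: $P'(t_1,\dots,t_n)$ is the number of anagrams without fixed letters of the word $1^{t_1}2^{t_2}\cdots n^{t_n}$, i.e. the number of words $a_{1,1}\ldots a_{1,t_1}\ldots a_{n,1}\ldots a_{n,t_n}$ that are rearrangements of $1^{t_1}\cdots n^{t_n}$ with $a_{i,j}\neq i$ for all $i,j$ (the empty word counts when all $t_i=0$). -}

module Defs where

open import Data.Nat using (ℕ; zero; suc; _+_; _^_; _/_; _%_)
open import Data.Fin using (Fin)
open import Data.Fin.Properties using (all?; _≟_)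
open import Data.Vec using (Vec; lookup; toList)
open import Data.List using (List; []; _∷_; [_]; length; filter; concatMap; map; allFin; replicate)
open import Data.Nat.ListAction using (sum)
open import Data.List.Relation.Binary.Pointwise as PW using (Pointwise)
open import Data.Product using (_×_)
open import Relation.Binary.PropositionalEquality using (_≡_; _≢_)
open import Relation.Nullary using (¬_; Dec)
open import Relation.Nullary.Decidable using (_×-dec_; ¬?)
import Data.Nat.Properties as ℕP

count : ∀ {A : Set} {P : A → Set} → (∀ a → Dec (P a)) → List A → ℕ
count P? xs = length (filter P? xs)

baseWord : ∀ {n} → Vec ℕ n → List (Fin n)
baseWord {n} t = concatMap (λ i → replicate (lookup t i) i) (allFin n)

wordsOfLength : (n m : ℕ) → List (List (Fin n))
wordsOfLength n zero    = [ [] ]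
wordsOfLength n (suc m) = concatMap (λ w → map (_∷ w) (allFin n)) (wordsOfLength n m)

IsAnagram : ∀ {n} → Vec ℕ n → List (Fin n) → Set
IsAnagram t w = ∀ k → count (k ≟_) w ≡ lookup t k

NoFixedLetter : ∀ {n} → Vec ℕ n → List (Fin n) → Set
NoFixedLetter t w = Pointwise _≢_ w (baseWord t)

isAnagram? : ∀ {n} (t : Vec ℕ n) (w : List (Fin n)) → Dec (IsAnagram t w)
isAnagram? t w = all? (λ k → count (k ≟_) w ℕP.≟ lookup t k)

noFixedLetter? : ∀ {n} (t : Vec ℕ n) (w : List (Fin n)) → Dec (NoFixedLetter t w)
noFixedLetter? t w = PW.decidable (λ a b → ¬? (a ≟ b)) w (baseWord t)

P′ : ∀ {n} → Vec ℕ n → ℕ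
P′ {n} t = length (filter (λ w → isAnagram? t w ×-dec noFixedLetter? t w)
                          (wordsOfLength n (sum (toList t))))

-- binary digit of m in position x  (= ⌊m / 2^x⌋ mod 2)
bit : ℕ → ℕ → ℕ
bit m zero    = m % 2
bit m (suc x) = bit (m / 2) x

bitCount : ∀ {n} → Vec ℕ n → ℕ → ℕ
bitCount {n} t x = count (λ i → bit (lookup t i) x ℕP.≟ 1) (allFin n)

-- A word without fixed letters is built position by position against the base
-- word b = 1^{t_1} … n^{t_n}; this gives a recursion `fill` over the base word
-- (one sum over the letter placed), and P′(t) is its value on b = baseWord t.
-- Three facts about this recursion drive the proof:
--   * it does not depend on the order of the letters of b (adjacent letters
--     commute, since the two-letter sum is symmetric);
--   * modulo 2, a doubled letter x x in b may be treated as one "double step"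
--     placing two equal letters, because the off-diagonal part of a symmetric
--     double sum is even;
--   * consequently, writing t = ε + 2u with ε ∈ {0,1}ⁿ, P′(t) ≡ P′(ε) · P′(u).
-- For a 0/1 vector ε, P′(ε) is a derangement number, and D_m ≡ m + 1 (mod 2);
-- we prove the more general parity formula for partial derangements by
-- induction on the base word.  Since ε counts the indices whose last binary
-- digit is 1 and u = ⌊t/2⌋ shifts the digits, induction on |t| gives:
--   P′(t) odd  ⇔  every bit position is set in an even number of the t_i.
module Submission where

open import Defs
open import Data.Nat using (ℕ; zero; suc; _+_; _*_; _∸_; _≤_; z≤n; s≤s; _%_; _/_; pred)
import Data.Nat.Properties as ℕP
open import Data.Nat.DivMod using (%-distribˡ-+; %-distribˡ-*; m*n%n≡0; m%n%n≡m%n; m%n<n; m≡m%n+[m/n]*n)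
open import Data.Nat.Solver using (module +-*-Solver)
import Data.Nat.ListAction as ListAction
open import Data.Fin using (Fin; zero; suc)
open import Data.Fin.Properties using (suc-injective) renaming (_≟_ to _≟F_)
open import Data.Vec using (Vec; []; _∷_; lookup; toList; updateAt; zipWith)
import Data.Vec as Vec
open import Data.Vec.Properties using (lookup-map; lookup-zipWith; lookup∘updateAt; lookup∘updateAt′; updateAt-commutes)
open import Data.List using (List; []; _∷_; [_]; map; concatMap; tabulate; allFin; _++_; length; filter; replicate)
import Data.List.Properties as ListP
open import Data.List.Relation.Binary.Pointwise using (Pointwise; []; _∷_)
import Data.List.Relation.Binary.Pointwise as Pointwise
open import Data.List.Relation.Binary.Permutation.Propositional as ↭ using (_↭_; ↭-trans; ↭-reflexive)
import Data.List.Relation.Binary.Permutation.Propositional.Properties as ↭P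
open import Data.Product using (_×_; _,_; proj₁)
open import Data.Product.Function.NonDependent.Propositional using (_×-⇔_)
open import Data.Empty using (⊥-elim)
open import Function using (_∘_; _⇔_; mk⇔; Equivalence)
open import Function.Properties.Equivalence using (⇔-setoid) renaming (trans to ⇔-trans)
open import Level using (0ℓ)
open import Relation.Binary.Bundles using (Setoid)
import Relation.Binary.Reasoning.Setoid as SetoidReasoning
open import Relation.Binary.PropositionalEquality hiding ([_])
open import Relation.Nullary using (Dec; yes; no; ¬_)
open import Relation.Nullary.Decidable using (_×-dec_; ¬?)
open import Algebra.Properties.CommutativeMonoid.Sum ℕP.+-0-commutativeMonoid
  using (sum; sum-syntax; ∑-distrib-+; ∑-comm; sum-cong-≗; sum-replicate-zero)
open import Algebra.Properties.Semiring.Sum ℕP.+-*-semiring using (*-distribˡ-sum)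
open +-*-Solver using (solve; _:+_; _:*_; _:=_; con)

∑ᴸ : ∀ {A : Set} → List A → (A → ℕ) → ℕ
∑ᴸ [] f = 0
∑ᴸ (x ∷ xs) f = f x + ∑ᴸ xs f

∑ᴸ-cong : ∀ {A : Set} (xs : List A) {f g : A → ℕ} → (∀ x → f x ≡ g x) → ∑ᴸ xs f ≡ ∑ᴸ xs g
∑ᴸ-cong [] e = refl
∑ᴸ-cong (x ∷ xs) e = cong₂ _+_ (e x) (∑ᴸ-cong xs e)

∑ᴸ-++ : ∀ {A : Set} (xs ys : List A) (f : A → ℕ) → ∑ᴸ (xs ++ ys) f ≡ ∑ᴸ xs f + ∑ᴸ ys f
∑ᴸ-++ [] ys f = refl
∑ᴸ-++ (x ∷ xs) ys f = trans (cong (f x +_) (∑ᴸ-++ xs ys f)) (sym (ℕP.+-assoc (f x) _ _))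

∑ᴸ-map : ∀ {A B : Set} (g : A → B) (xs : List A) (f : B → ℕ) → ∑ᴸ (map g xs) f ≡ ∑ᴸ xs (f ∘ g)
∑ᴸ-map g [] f = refl
∑ᴸ-map g (x ∷ xs) f = cong (f (g x) +_) (∑ᴸ-map g xs f)

∑ᴸ-concatMap : ∀ {A B : Set} (g : A → List B) (xs : List A) (f : B → ℕ) →
               ∑ᴸ (concatMap g xs) f ≡ ∑ᴸ xs (λ x → ∑ᴸ (g x) f)
∑ᴸ-concatMap g [] f = refl
∑ᴸ-concatMap g (x ∷ xs) f =
  trans (∑ᴸ-++ (g x) (concatMap g xs) f) (cong (∑ᴸ (g x) f +_) (∑ᴸ-concatMap g xs f))

∑ᴸ-tabulate : ∀ {A : Set} n (g : Fin n → A) (f : A → ℕ) → ∑ᴸ (tabulate g) f ≡ ∑[ i < n ] f (g i)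
∑ᴸ-tabulate zero g f = refl
∑ᴸ-tabulate (suc n) g f = cong (f (g zero) +_) (∑ᴸ-tabulate n (g ∘ suc) f)

∑ᴸ-allFin : ∀ n (f : Fin n → ℕ) → ∑ᴸ (allFin n) f ≡ ∑[ i < n ] f i
∑ᴸ-allFin n f = ∑ᴸ-tabulate n (λ i → i) f

∑ᴸ-replicate : ∀ {A : Set} m (x : A) (f : A → ℕ) → ∑ᴸ (replicate m x) f ≡ m * f x
∑ᴸ-replicate zero x f = refl
∑ᴸ-replicate (suc m) x f = cong (f x +_) (∑ᴸ-replicate m x f)

∑ᴸ-+ : ∀ {A : Set} (xs : List A) (f g : A → ℕ) → ∑ᴸ xs (λ x → f x + g x) ≡ ∑ᴸ xs f + ∑ᴸ xs g
∑ᴸ-+ [] f g = refl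
∑ᴸ-+ (x ∷ xs) f g = trans (cong (f x + g x +_) (∑ᴸ-+ xs f g))
  (solve 4 (λ a b c d → a :+ b :+ (c :+ d) := a :+ c :+ (b :+ d)) refl (f x) (g x) (∑ᴸ xs f) (∑ᴸ xs g))

∑ᴸ-*ˡ : ∀ {A : Set} (a : ℕ) (xs : List A) (f : A → ℕ) → ∑ᴸ xs (λ x → a * f x) ≡ a * ∑ᴸ xs f
∑ᴸ-*ˡ a [] f = sym (ℕP.*-zeroʳ a)
∑ᴸ-*ˡ a (x ∷ xs) f = trans (cong (a * f x +_) (∑ᴸ-*ˡ a xs f)) (sym (ℕP.*-distribˡ-+ a (f x) _))

∑ᴸ-∑-comm : ∀ {A : Set} (xs : List A) n (h : A → Fin n → ℕ) →
            ∑ᴸ xs (λ x → ∑[ k < n ] h x k) ≡ ∑[ k < n ] ∑ᴸ xs (λ x → h x k)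
∑ᴸ-∑-comm [] n h = sym (sum-replicate-zero n)
∑ᴸ-∑-comm (x ∷ xs) n h = trans (cong (sum (h x) +_) (∑ᴸ-∑-comm xs n h)) (sym (∑-distrib-+ (h x) _))

𝟙 : ∀ {P : Set} → Dec P → ℕ
𝟙 (yes _) = 1
𝟙 (no _) = 0

𝟙-⇔ : ∀ {P Q : Set} → (P → Q) → (Q → P) → (p : Dec P) (q : Dec Q) → 𝟙 p ≡ 𝟙 q
𝟙-⇔ f g (yes p) (yes q) = refl
𝟙-⇔ f g (yes p) (no ¬q) = ⊥-elim (¬q (f p))
𝟙-⇔ f g (no ¬p) (yes q) = ⊥-elim (¬p (g q))
𝟙-⇔ f g (no ¬p) (no ¬q) = refl

𝟙-yes : ∀ {P : Set} → P → (p : Dec P) → 𝟙 p ≡ 1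
𝟙-yes p (yes _) = refl
𝟙-yes p (no ¬p) = ⊥-elim (¬p p)

𝟙-no : ∀ {P : Set} → ¬ P → (p : Dec P) → 𝟙 p ≡ 0
𝟙-no ¬p (yes p) = ⊥-elim (¬p p)
𝟙-no ¬p (no _) = refl

length-filter : ∀ {A : Set} {P : A → Set} (P? : ∀ x → Dec (P x)) (xs : List A) →
                length (filter P? xs) ≡ ∑ᴸ xs (λ x → 𝟙 (P? x))
length-filter P? [] = refl
length-filter P? (x ∷ xs) with P? x
... | yes _ = cong suc (length-filter P? xs)
... | no _ = length-filter P? xs

𝟙[_≢_] : ∀ {n} → Fin n → Fin n → ℕ
𝟙[ k ≢ x ] with k ≟F x
... | yes _ = 0
... | no _ = 1

𝟙≢-idem : ∀ {n} (k x : Fin n) → 𝟙[ k ≢ x ] * 𝟙[ k ≢ x ] ≡ 𝟙[ k ≢ x ]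
𝟙≢-idem k x with k ≟F x
... | yes _ = refl
... | no _ = refl

𝟙≢+𝟙≡ : ∀ {n} (k x : Fin n) → 𝟙[ k ≢ x ] + 𝟙 (k ≟F x) ≡ 1
𝟙≢+𝟙≡ k x with k ≟F x
... | yes _ = refl
... | no _ = refl

𝟙[_≥1] : ℕ → ℕ
𝟙[ zero ≥1] = 0
𝟙[ suc _ ≥1] = 1

𝟙[_≥2] : ℕ → ℕ
𝟙[ suc (suc _) ≥2] = 1
𝟙[ _ ≥2] = 0

-- Congruence modulo 2, wrapped in a record so that both sides stay inferable.

infix 4 _≡₂_
record _≡₂_ (a b : ℕ) : Set where
  constructor mod2
  field mod2-eq : a % 2 ≡ b % 2
open _≡₂_

≡₂-setoid : Setoid 0ℓ 0ℓ
≡₂-setoid = record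
  { Carrier = ℕ
  ; _≈_ = _≡₂_
  ; isEquivalence = record
    { refl = mod2 refl
    ; sym = λ (mod2 p) → mod2 (sym p)
    ; trans = λ (mod2 p) (mod2 q) → mod2 (trans p q)
    }
  }

module ≡₂-Reasoning = SetoidReasoning ≡₂-setoid

open Setoid ≡₂-setoid using () renaming (refl to ≡₂-refl; sym to ≡₂-sym; trans to ≡₂-trans)

≡⇒≡₂ : ∀ {a b} → a ≡ b → a ≡₂ b
≡⇒≡₂ refl = ≡₂-refl

≡₂-+ : ∀ {a b c d} → a ≡₂ b → c ≡₂ d → a + c ≡₂ b + d
≡₂-+ {a} {b} {c} {d} (mod2 p) (mod2 q) = mod2 (begin
  (a + c) % 2           ≡⟨ %-distribˡ-+ a c 2 ⟩
  (a % 2 + c % 2) % 2   ≡⟨ cong₂ (λ x y → (x + y) % 2) p q ⟩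
  (b % 2 + d % 2) % 2   ≡⟨ %-distribˡ-+ b d 2 ⟨
  (b + d) % 2           ∎)
  where open ≡-Reasoning

≡₂-*ˡ : ∀ a {b c} → b ≡₂ c → a * b ≡₂ a * c
≡₂-*ˡ zero p = ≡₂-refl
≡₂-*ˡ (suc a) p = ≡₂-+ p (≡₂-*ˡ a p)

≡₂-double : ∀ a b → a + a + b ≡₂ b
≡₂-double a b = mod2 (begin
  (a + a + b) % 2             ≡⟨ cong (λ z → (z + b) % 2) (solve 1 (λ x → x :+ x := x :* con 2) refl a) ⟩
  (a * 2 + b) % 2             ≡⟨ %-distribˡ-+ (a * 2) b 2 ⟩
  ((a * 2) % 2 + b % 2) % 2   ≡⟨ cong (λ z → (z + b % 2) % 2) (m*n%n≡0 a 2) ⟩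
  (b % 2) % 2                 ≡⟨ m%n%n≡m%n b 2 ⟩
  b % 2                       ∎)
  where open ≡-Reasoning

≡₂-∑ : ∀ n {f g : Fin n → ℕ} → (∀ k → f k ≡₂ g k) → ∑[ k < n ] f k ≡₂ ∑[ k < n ] g k
≡₂-∑ zero e = ≡₂-refl
≡₂-∑ (suc n) e = ≡₂-+ (e zero) (≡₂-∑ n (e ∘ suc))

-- A symmetric double sum has the parity of its diagonal: off-diagonal terms pair up.
∑-symmetric : ∀ n (h : Fin n → Fin n → ℕ) → (∀ k l → h k l ≡ h l k) →
              ∑[ k < n ] ∑[ l < n ] h k l ≡₂ ∑[ k < n ] h k k
∑-symmetric zero h symm = ≡₂-refl
∑-symmetric (suc n) h symm = begin
  (h zero zero + row) + ∑[ k < n ] (h (suc k) zero + ∑[ l < n ] h (suc k) (suc l))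
    ≡⟨ cong (h zero zero + row +_) (∑-distrib-+ (λ k → h (suc k) zero) _) ⟩
  (h zero zero + row) + (column + rest)
    ≡⟨ cong (λ z → h zero zero + row + (z + rest)) column≡row ⟩
  (h zero zero + row) + (row + rest)
    ≡⟨ solve 3 (λ x a c → x :+ a :+ (a :+ c) := a :+ a :+ (x :+ c)) refl (h zero zero) row rest ⟩
  row + row + (h zero zero + rest)
    ≈⟨ ≡₂-double row _ ⟩
  h zero zero + rest
    ≈⟨ ≡₂-+ (≡₂-refl {h zero zero}) (∑-symmetric n (λ k l → h (suc k) (suc l)) (λ k l → symm (suc k) (suc l))) ⟩
  h zero zero + ∑[ k < n ] h (suc k) (suc k) ∎
  where
  open ≡₂-Reasoning
  row = ∑[ l < n ] h zero (suc l)
  column = ∑[ k < n ] h (suc k) zero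
  rest = ∑[ k < n ] ∑[ l < n ] h (suc k) (suc l)
  column≡row : column ≡ row
  column≡row = sum-cong-≗ (λ k → symm (suc k) zero)

-- Multisets over Fin n are vectors of multiplicities.

_-₁_ : ∀ {n} → Vec ℕ n → Fin n → Vec ℕ n
c -₁ k = updateAt c k pred

remove-comm : ∀ {n} (c : Vec ℕ n) k l → (c -₁ k) -₁ l ≡ (c -₁ l) -₁ k
remove-comm c k l with k ≟F l
... | yes refl = refl
... | no k≢l = updateAt-commutes l k (k≢l ∘ sym) c

total : ∀ {n} → Vec ℕ n → ℕ
total {n} c = ∑[ k < n ] lookup c k

total-remove : ∀ {n} (c : Vec ℕ n) k m → lookup c k ≡ suc m → total c ≡ suc (total (c -₁ k))
total-remove (.(suc m) ∷ c) zero m refl = refl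
total-remove (x ∷ c) (suc k) m eq = trans (cong (x +_) (total-remove c k m eq)) (ℕP.+-suc x _)

total≡0 : ∀ {n} (c : Vec ℕ n) → total c ≡ 0 → ∀ k → lookup c k ≡ 0
total≡0 (zero ∷ c) e zero = refl
total≡0 (zero ∷ c) e (suc k) = total≡0 c e k

total-toList : ∀ {n} (t : Vec ℕ n) → total t ≡ ListAction.sum (toList t)
total-toList [] = refl
total-toList (x ∷ t) = cong (x +_) (total-toList t)

-- Filling a base word.  fill b g c runs over the words that can be written
-- under the letters of b, using letters of the multiset c and never the base
-- letter of the position; g weighs the multiset of unused letters.

fill : ∀ {n} → List (Fin n) → (Vec ℕ n → ℕ) → Vec ℕ n → ℕ
fill [] g c = g c
fill {n} (x ∷ b) g c = ∑[ k < n ] (𝟙[ k ≢ x ] * (𝟙[ lookup c k ≥1] * fill b g (c -₁ k)))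

isEmpty : ∀ {n} → Vec ℕ n → ℕ
isEmpty c = 𝟙 (isAnagram? c [])

avoiders : ∀ {n} → List (Fin n) → Vec ℕ n → ℕ
avoiders b = fill b isEmpty

avoids? : ∀ {n} (b w : List (Fin n)) → Dec (Pointwise _≢_ w b)
avoids? b w = Pointwise.decidable (λ a a′ → ¬? (a ≟F a′)) w b

count-∷ : ∀ {n} (i k : Fin n) w → count (i ≟F_) (k ∷ w) ≡ 𝟙 (i ≟F k) + count (i ≟F_) w
count-∷ i k w with i ≟F k
... | yes _ = refl
... | no _ = refl

count-∷-same : ∀ {n} (k : Fin n) w → count (k ≟F_) (k ∷ w) ≡ suc (count (k ≟F_) w)
count-∷-same k w = trans (count-∷ k k w) (cong (_+ count (k ≟F_) w) (𝟙-yes refl (k ≟F k)))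

count-∷-other : ∀ {n} (i k : Fin n) w → i ≢ k → count (i ≟F_) (k ∷ w) ≡ count (i ≟F_) w
count-∷-other i k w i≢k = trans (count-∷ i k w) (cong (_+ count (i ≟F_) w) (𝟙-no i≢k (i ≟F k)))

anagram-∷ : ∀ {n} (c : Vec ℕ n) k w m → lookup c k ≡ suc m →
            IsAnagram c (k ∷ w) ⇔ IsAnagram (c -₁ k) w
anagram-∷ c k w m ck = mk⇔ forward backward
  where
  forward : IsAnagram c (k ∷ w) → IsAnagram (c -₁ k) w
  forward A i = by-letter (i ≟F k)
    where
    open ≡-Reasoning
    by-letter : Dec (i ≡ k) → count (i ≟F_) w ≡ lookup (c -₁ k) i
    by-letter (yes refl) = begin
      count (i ≟F_) w               ≡⟨ cong pred (count-∷-same i w) ⟨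
      pred (count (i ≟F_) (i ∷ w))  ≡⟨ cong pred (A i) ⟩
      pred (lookup c i)             ≡⟨ lookup∘updateAt i c ⟨
      lookup (c -₁ i) i             ∎
    by-letter (no i≢k) = begin
      count (i ≟F_) w        ≡⟨ count-∷-other i k w i≢k ⟨
      count (i ≟F_) (k ∷ w)  ≡⟨ A i ⟩
      lookup c i             ≡⟨ lookup∘updateAt′ i k i≢k c ⟨
      lookup (c -₁ k) i      ∎
  backward : IsAnagram (c -₁ k) w → IsAnagram c (k ∷ w)
  backward A i = by-letter (i ≟F k)
    where
    open ≡-Reasoning
    by-letter : Dec (i ≡ k) → count (i ≟F_) (k ∷ w) ≡ lookup c i
    by-letter (yes refl) = begin
      count (i ≟F_) (i ∷ w)        ≡⟨ count-∷-same i w ⟩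
      suc (count (i ≟F_) w)        ≡⟨ cong suc (A i) ⟩
      suc (lookup (c -₁ i) i)      ≡⟨ cong suc (lookup∘updateAt i c) ⟩
      suc (pred (lookup c i))      ≡⟨ cong (λ z → suc (pred z)) ck ⟩
      suc m                        ≡⟨ ck ⟨
      lookup c i                   ∎
    by-letter (no i≢k) = begin
      count (i ≟F_) (k ∷ w)  ≡⟨ count-∷-other i k w i≢k ⟩
      count (i ≟F_) w        ≡⟨ A i ⟩
      lookup (c -₁ k) i      ≡⟨ lookup∘updateAt′ i k i≢k c ⟩
      lookup c i             ∎

anagram-∷-absent : ∀ {n} (c : Vec ℕ n) k w → lookup c k ≡ 0 → ¬ IsAnagram c (k ∷ w)
anagram-∷-absent c k w ck A with trans (sym (count-∷-same k w)) (trans (A k) ck)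
... | ()

accepts : ∀ {n} → List (Fin n) → Vec ℕ n → List (Fin n) → ℕ
accepts b c w = 𝟙 (isAnagram? c w ×-dec avoids? b w)

accepts-∷ : ∀ {n} (x : Fin n) b (c : Vec ℕ n) k w →
            accepts (x ∷ b) c (k ∷ w) ≡ 𝟙[ k ≢ x ] * (𝟙[ lookup c k ≥1] * accepts b (c -₁ k) w)
accepts-∷ x b c k w with k ≟F x
... | yes refl = 𝟙-no (λ { (_ , (k≢k ∷ _)) → k≢k refl }) _
... | no k≢x with lookup c k in ck
...   | zero = 𝟙-no (λ { (A , _) → anagram-∷-absent c k w ck A }) _
...   | suc m = trans
        (𝟙-⇔ (λ { (A , (_ ∷ p)) → Equivalence.to (anagram-∷ c k w m ck) A , p })
             (λ { (A , p) → Equivalence.from (anagram-∷ c k w m ck) A , (k≢x ∷ p) })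
             _ (isAnagram? (c -₁ k) w ×-dec avoids? b w))
        (sym (trans (ℕP.*-identityˡ _) (ℕP.*-identityˡ _)))

avoiders-counts : ∀ {n} (b : List (Fin n)) c →
  length (filter (λ w → isAnagram? c w ×-dec avoids? b w) (wordsOfLength n (length b))) ≡ avoiders b c
avoiders-counts {n} [] c = trans (length-filter (λ w → isAnagram? c w ×-dec avoids? [] w) [ [] ])
  (trans (ℕP.+-identityʳ _) (𝟙-⇔ proj₁ (λ A → A , Pointwise.[]) (isAnagram? c [] ×-dec avoids? [] []) _))
avoiders-counts {n} (x ∷ b) c = begin
  length (filter _ (concatMap (λ w → map (_∷ w) (allFin n)) ws))
    ≡⟨ length-filter _ (concatMap (λ w → map (_∷ w) (allFin n)) ws) ⟩
  ∑ᴸ (concatMap (λ w → map (_∷ w) (allFin n)) ws) (accepts (x ∷ b) c)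
    ≡⟨ ∑ᴸ-concatMap _ ws _ ⟩
  ∑ᴸ ws (λ w → ∑ᴸ (map (_∷ w) (allFin n)) (accepts (x ∷ b) c))
    ≡⟨ ∑ᴸ-cong ws (λ w → trans (∑ᴸ-map _ (allFin n) _) (∑ᴸ-allFin n _)) ⟩
  ∑ᴸ ws (λ w → ∑[ k < n ] accepts (x ∷ b) c (k ∷ w))
    ≡⟨ ∑ᴸ-∑-comm ws n _ ⟩
  ∑[ k < n ] ∑ᴸ ws (λ w → accepts (x ∷ b) c (k ∷ w))
    ≡⟨ sum-cong-≗ (λ k → trans (∑ᴸ-cong ws (accepts-∷ x b c k)) (pull k)) ⟩
  ∑[ k < n ] (𝟙[ k ≢ x ] * (𝟙[ lookup c k ≥1] * ∑ᴸ ws (accepts b (c -₁ k))))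
    ≡⟨ sum-cong-≗ (λ k → cong (λ z → 𝟙[ k ≢ x ] * (𝟙[ lookup c k ≥1] * z)) (recurse k)) ⟩
  avoiders (x ∷ b) c ∎
  where
  open ≡-Reasoning
  ws = wordsOfLength n (length b)
  pull : ∀ k → ∑ᴸ ws (λ w → 𝟙[ k ≢ x ] * (𝟙[ lookup c k ≥1] * accepts b (c -₁ k) w))
             ≡ 𝟙[ k ≢ x ] * (𝟙[ lookup c k ≥1] * ∑ᴸ ws (accepts b (c -₁ k)))
  pull k = trans (∑ᴸ-*ˡ 𝟙[ k ≢ x ] ws _) (cong (𝟙[ k ≢ x ] *_) (∑ᴸ-*ˡ 𝟙[ lookup c k ≥1] ws _))
  recurse : ∀ k → ∑ᴸ ws (accepts b (c -₁ k)) ≡ avoiders b (c -₁ k)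
  recurse k = trans (sym (length-filter _ ws)) (avoiders-counts b (c -₁ k))

length-concatMap : ∀ {A B : Set} (f : A → List B) (xs : List A) →
                   length (concatMap f xs) ≡ ∑ᴸ xs (λ x → length (f x))
length-concatMap f [] = refl
length-concatMap f (x ∷ xs) = trans (ListP.length-++ (f x)) (cong (length (f x) +_) (length-concatMap f xs))

length-baseWord : ∀ {n} (t : Vec ℕ n) → length (baseWord t) ≡ total t
length-baseWord {n} t = begin
  length (concatMap (λ i → replicate (lookup t i) i) (allFin n))
    ≡⟨ length-concatMap _ (allFin n) ⟩
  ∑ᴸ (allFin n) (λ i → length (replicate (lookup t i) i))
    ≡⟨ ∑ᴸ-allFin n _ ⟩
  ∑[ i < n ] length (replicate (lookup t i) i)
    ≡⟨ sum-cong-≗ (λ i → ListP.length-replicate (lookup t i)) ⟩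
  total t ∎
  where open ≡-Reasoning

P′≡avoiders : ∀ {n} (t : Vec ℕ n) → P′ t ≡ avoiders (baseWord t) t
P′≡avoiders {n} t = trans
  (cong (λ m → length (filter (λ w → isAnagram? t w ×-dec noFixedLetter? t w) (wordsOfLength n m)))
        (trans (sym (total-toList t)) (sym (length-baseWord t))))
  (avoiders-counts (baseWord t) t)

fill-cong : ∀ {n} (b : List (Fin n)) {g g′ : Vec ℕ n → ℕ} → (∀ d → g d ≡ g′ d) → ∀ c → fill b g c ≡ fill b g′ c
fill-cong [] e c = e c
fill-cong (x ∷ b) e c = sum-cong-≗ (λ k → cong (λ z → 𝟙[ k ≢ x ] * (𝟙[ lookup c k ≥1] * z)) (fill-cong b e (c -₁ k)))

fill-*ˡ : ∀ {n} (b : List (Fin n)) a g c → fill b (λ d → a * g d) c ≡ a * fill b g c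
fill-*ˡ [] a g c = refl
fill-*ˡ {n} (x ∷ b) a g c =
  trans (sum-cong-≗ step) (sym (*-distribˡ-sum a (λ k → 𝟙[ k ≢ x ] * (𝟙[ lookup c k ≥1] * fill b g (c -₁ k)))))
  where
  step : ∀ k → 𝟙[ k ≢ x ] * (𝟙[ lookup c k ≥1] * fill b (λ d → a * g d) (c -₁ k))
             ≡ a * (𝟙[ k ≢ x ] * (𝟙[ lookup c k ≥1] * fill b g (c -₁ k)))
  step k = trans (cong (λ z → 𝟙[ k ≢ x ] * (𝟙[ lookup c k ≥1] * z)) (fill-*ˡ b a g (c -₁ k)))
    (solve 4 (λ u v a f → u :* (v :* (a :* f)) := a :* (u :* (v :* f))) refl
      𝟙[ k ≢ x ] 𝟙[ lookup c k ≥1] a (fill b g (c -₁ k)))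

twoSteps : ∀ {n} → Fin n → Fin n → List (Fin n) → (Vec ℕ n → ℕ) → Vec ℕ n → Fin n → Fin n → ℕ
twoSteps x y b g c k l =
  𝟙[ k ≢ x ] * (𝟙[ l ≢ y ] * ((𝟙[ lookup c k ≥1] * 𝟙[ lookup (c -₁ k) l ≥1]) * fill b g ((c -₁ k) -₁ l)))

fill-twoSteps : ∀ {n} x y b g (c : Vec ℕ n) →
                fill (x ∷ y ∷ b) g c ≡ ∑[ k < n ] ∑[ l < n ] twoSteps x y b g c k l
fill-twoSteps {n} x y b g c = sum-cong-≗ λ k → begin
  𝟙[ k ≢ x ] * (𝟙[ lookup c k ≥1] * ∑[ l < n ] second k l)
    ≡⟨ cong (𝟙[ k ≢ x ] *_) (*-distribˡ-sum 𝟙[ lookup c k ≥1] (second k)) ⟩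
  𝟙[ k ≢ x ] * ∑[ l < n ] (𝟙[ lookup c k ≥1] * second k l)
    ≡⟨ *-distribˡ-sum 𝟙[ k ≢ x ] (λ l → 𝟙[ lookup c k ≥1] * second k l) ⟩
  ∑[ l < n ] (𝟙[ k ≢ x ] * (𝟙[ lookup c k ≥1] * second k l))
    ≡⟨ sum-cong-≗ (λ l → solve 5 (λ u p v q f → u :* (p :* (v :* (q :* f))) := u :* (v :* ((p :* q) :* f))) refl
         𝟙[ k ≢ x ] 𝟙[ lookup c k ≥1] 𝟙[ l ≢ y ] 𝟙[ lookup (c -₁ k) l ≥1] (fill b g ((c -₁ k) -₁ l))) ⟩
  ∑[ l < n ] twoSteps x y b g c k l ∎
  where
  open ≡-Reasoning
  second : Fin n → Fin n → ℕ
  second k l = 𝟙[ l ≢ y ] * (𝟙[ lookup (c -₁ k) l ≥1] * fill b g ((c -₁ k) -₁ l))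

available-comm : ∀ {n} (c : Vec ℕ n) k l →
  𝟙[ lookup c k ≥1] * 𝟙[ lookup (c -₁ k) l ≥1] ≡ 𝟙[ lookup c l ≥1] * 𝟙[ lookup (c -₁ l) k ≥1]
available-comm c k l with k ≟F l
... | yes refl = refl
... | no k≢l = begin
  𝟙[ lookup c k ≥1] * 𝟙[ lookup (c -₁ k) l ≥1]
    ≡⟨ cong (λ z → 𝟙[ lookup c k ≥1] * 𝟙[ z ≥1]) (lookup∘updateAt′ l k (k≢l ∘ sym) c) ⟩
  𝟙[ lookup c k ≥1] * 𝟙[ lookup c l ≥1]
    ≡⟨ ℕP.*-comm 𝟙[ lookup c k ≥1] _ ⟩
  𝟙[ lookup c l ≥1] * 𝟙[ lookup c k ≥1]
    ≡⟨ cong (λ z → 𝟙[ lookup c l ≥1] * 𝟙[ z ≥1]) (lookup∘updateAt′ k l k≢l c) ⟨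
  𝟙[ lookup c l ≥1] * 𝟙[ lookup (c -₁ l) k ≥1]  ∎
  where open ≡-Reasoning

twoSteps-swap : ∀ {n} x y b g (c : Vec ℕ n) k l → twoSteps x y b g c k l ≡ twoSteps y x b g c l k
twoSteps-swap x y b g c k l = trans
  (solve 3 (λ u v r → u :* (v :* r) := v :* (u :* r)) refl 𝟙[ k ≢ x ] 𝟙[ l ≢ y ]
    ((𝟙[ lookup c k ≥1] * 𝟙[ lookup (c -₁ k) l ≥1]) * fill b g ((c -₁ k) -₁ l)))
  (cong (λ z → 𝟙[ l ≢ y ] * (𝟙[ k ≢ x ] * z)) (cong₂ _*_ (available-comm c k l) (cong (fill b g) (remove-comm c k l))))

-- Two adjacent base letters commute: interchange the two sums of twoSteps.
fill-swap : ∀ {n} x y b g (c : Vec ℕ n) → fill (x ∷ y ∷ b) g c ≡ fill (y ∷ x ∷ b) g c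
fill-swap {n} x y b g c = begin
  fill (x ∷ y ∷ b) g c                             ≡⟨ fill-twoSteps x y b g c ⟩
  ∑[ k < n ] ∑[ l < n ] twoSteps x y b g c k l     ≡⟨ ∑-comm (twoSteps x y b g c) ⟩
  ∑[ l < n ] ∑[ k < n ] twoSteps x y b g c k l     ≡⟨ sum-cong-≗ (λ l → sum-cong-≗ (λ k → twoSteps-swap x y b g c k l)) ⟩
  ∑[ l < n ] ∑[ k < n ] twoSteps y x b g c l k     ≡⟨ fill-twoSteps y x b g c ⟨
  fill (y ∷ x ∷ b) g c                             ∎
  where open ≡-Reasoning

fill-↭ : ∀ {n} {b b′ : List (Fin n)} → b ↭ b′ → ∀ g c → fill b g c ≡ fill b′ g c
fill-↭ ↭.refl g c = refl
fill-↭ (↭.prep x p) g c = sum-cong-≗ (λ k → cong (λ z → 𝟙[ k ≢ x ] * (𝟙[ lookup c k ≥1] * z)) (fill-↭ p g (c -₁ k)))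
fill-↭ {b = x ∷ y ∷ b} (↭.swap x y p) g c = trans (fill-swap x y b g c) (sum-cong-≗ λ k →
  cong (λ z → 𝟙[ k ≢ y ] * (𝟙[ lookup c k ≥1] * z)) (sum-cong-≗ λ l →
  cong (λ z → 𝟙[ l ≢ x ] * (𝟙[ lookup (c -₁ k) l ≥1] * z)) (fill-↭ p g ((c -₁ k) -₁ l))))
fill-↭ (↭.trans p q) g c = trans (fill-↭ p g c) (fill-↭ q g c)

-- Modulo 2, a doubled base letter x x acts as one step placing two equal letters.

double : ∀ {A : Set} → List A → List A
double [] = []
double (x ∷ xs) = x ∷ x ∷ double xs

fill₂ : ∀ {n} → List (Fin n) → (Vec ℕ n → ℕ) → Vec ℕ n → ℕ
fill₂ [] g c = g c
fill₂ {n} (x ∷ b) g c = ∑[ k < n ] (𝟙[ k ≢ x ] * (𝟙[ lookup c k ≥2] * fill₂ b g ((c -₁ k) -₁ k)))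

available-twice : ∀ {n} (c : Vec ℕ n) k → 𝟙[ lookup c k ≥1] * 𝟙[ lookup (c -₁ k) k ≥1] ≡ 𝟙[ lookup c k ≥2]
available-twice c k rewrite lookup∘updateAt k {pred} c with lookup c k
... | zero = refl
... | suc zero = refl
... | suc (suc _) = refl

twoSteps-diagonal : ∀ {n} x b g (c : Vec ℕ n) k →
  twoSteps x x b g c k k ≡ 𝟙[ k ≢ x ] * (𝟙[ lookup c k ≥2] * fill b g ((c -₁ k) -₁ k))
twoSteps-diagonal x b g c k = trans (sym (ℕP.*-assoc 𝟙[ k ≢ x ] 𝟙[ k ≢ x ] _))
  (cong₂ _*_ (𝟙≢-idem k x) (cong (_* fill b g ((c -₁ k) -₁ k)) (available-twice c k)))

-- The symmetric double sum over the two equal letters reduces to its diagonal mod 2.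
fill-double : ∀ {n} (b′ b : List (Fin n)) g c → fill (double b′ ++ b) g c ≡₂ fill₂ b′ (fill b g) c
fill-double [] b g c = ≡₂-refl
fill-double {n} (x ∷ b′) b g c = begin
  fill (x ∷ x ∷ double b′ ++ b) g c
    ≡⟨ fill-twoSteps x x (double b′ ++ b) g c ⟩
  ∑[ k < n ] ∑[ l < n ] twoSteps x x (double b′ ++ b) g c k l
    ≈⟨ ∑-symmetric n _ (twoSteps-swap x x (double b′ ++ b) g c) ⟩
  ∑[ k < n ] twoSteps x x (double b′ ++ b) g c k k
    ≡⟨ sum-cong-≗ (twoSteps-diagonal x (double b′ ++ b) g c) ⟩
  ∑[ k < n ] (𝟙[ k ≢ x ] * (𝟙[ lookup c k ≥2] * fill (double b′ ++ b) g ((c -₁ k) -₁ k)))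
    ≈⟨ ≡₂-∑ n (λ k → ≡₂-*ˡ 𝟙[ k ≢ x ] (≡₂-*ˡ 𝟙[ lookup c k ≥2] (fill-double b′ b g ((c -₁ k) -₁ k)))) ⟩
  fill₂ (x ∷ b′) (fill b g) c ∎
  where open ≡₂-Reasoning

ZeroOne : ∀ {n} → Vec ℕ n → Set
ZeroOne {n} ε = ∀ (k : Fin n) → lookup ε k ≤ 1

_+2·_ : ∀ {n} → Vec ℕ n → Vec ℕ n → Vec ℕ n
ε +2· u = zipWith (λ e x → e + (x + x)) ε u

lookup-+2· : ∀ {n} (ε u : Vec ℕ n) k → lookup (ε +2· u) k ≡ lookup ε k + (lookup u k + lookup u k)
lookup-+2· ε u k = lookup-zipWith _ k ε u

+2·-suc : ∀ e m → e + (suc m + suc m) ≡ suc (suc (e + (m + m)))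
+2·-suc e m = solve 2 (λ e m → e :+ ((con 1 :+ m) :+ (con 1 :+ m)) := con 2 :+ (e :+ (m :+ m))) refl e m

remove-twice-+2· : ∀ {n} (ε u : Vec ℕ n) k m → lookup u k ≡ suc m → ((ε +2· u) -₁ k) -₁ k ≡ ε +2· (u -₁ k)
remove-twice-+2· (e ∷ ε) (.(suc m) ∷ u) zero m refl = cong (λ z → pred (pred z) ∷ (ε +2· u)) (+2·-suc e m)
remove-twice-+2· (e ∷ ε) (x ∷ u) (suc k) m uk = cong (e + (x + x) ∷_) (remove-twice-+2· ε u k m uk)

available-+2· : ∀ {n} (ε u : Vec ℕ n) → ZeroOne ε → ∀ k → 𝟙[ lookup (ε +2· u) k ≥2] ≡ 𝟙[ lookup u k ≥1]
available-+2· ε u ε01 k rewrite lookup-+2· ε u k with lookup ε k | ε01 k | lookup u k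
... | e | _ | suc m rewrite +2·-suc e m = refl
... | zero | _ | zero = refl
... | suc zero | _ | zero = refl
... | suc (suc _) | s≤s () | zero

fill₂-+2· : ∀ {n} (ε : Vec ℕ n) → ZeroOne ε → ∀ b g u → fill₂ b g (ε +2· u) ≡ fill b (g ∘ (ε +2·_)) u
fill₂-+2· ε ε01 [] g u = refl
fill₂-+2· ε ε01 (x ∷ b) g u = sum-cong-≗ step
  where
  step : ∀ k → 𝟙[ k ≢ x ] * (𝟙[ lookup (ε +2· u) k ≥2] * fill₂ b g (((ε +2· u) -₁ k) -₁ k))
             ≡ 𝟙[ k ≢ x ] * (𝟙[ lookup u k ≥1] * fill b (g ∘ (ε +2·_)) (u -₁ k))
  step k with lookup u k in uk
  ... | zero = cong (λ z → 𝟙[ k ≢ x ] * (z * fill₂ b g (((ε +2· u) -₁ k) -₁ k)))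
                    (trans (available-+2· ε u ε01 k) (cong 𝟙[_≥1] uk))
  ... | suc m = cong (𝟙[ k ≢ x ] *_) (cong₂ _*_
                  (trans (available-+2· ε u ε01 k) (cong 𝟙[_≥1] uk))
                  (trans (cong (fill₂ b g) (remove-twice-+2· ε u k m uk)) (fill₂-+2· ε ε01 b g (u -₁ k))))

-- Every rearrangement has the size of its base word.
avoiders-size : ∀ {n} (b : List (Fin n)) c → total c ≢ length b → avoiders b c ≡ 0
avoiders-size {n} [] c size≢ = 𝟙-no (λ A → size≢ (trans (sum-cong-≗ (λ k → sym (A k))) (sum-replicate-zero n))) _
avoiders-size {n} (x ∷ b) c size≢ = trans (sum-cong-≗ term) (sum-replicate-zero n)
  where
  term : ∀ k → 𝟙[ k ≢ x ] * (𝟙[ lookup c k ≥1] * avoiders b (c -₁ k)) ≡ 0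
  term k with lookup c k in ck
  ... | zero = ℕP.*-zeroʳ 𝟙[ k ≢ x ]
  ... | suc m = begin
    𝟙[ k ≢ x ] * (1 * avoiders b (c -₁ k)) ≡⟨ cong (λ z → 𝟙[ k ≢ x ] * (1 * z)) (avoiders-size b (c -₁ k) smaller≢) ⟩
    𝟙[ k ≢ x ] * (1 * 0)                  ≡⟨ ℕP.*-zeroʳ 𝟙[ k ≢ x ] ⟩
    0                                     ∎
    where
    open ≡-Reasoning
    smaller≢ : total (c -₁ k) ≢ length b
    smaller≢ e = size≢ (trans (total-remove c k m ck) (cong suc e))

+2·-zero : ∀ {n} (ε u : Vec ℕ n) → (∀ k → lookup u k ≡ 0) → ε +2· u ≡ ε
+2·-zero [] [] u≡0 = refl
+2·-zero (e ∷ ε) (x ∷ u) u≡0 =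
  cong₂ _∷_ (trans (cong (λ y → e + (y + y)) (u≡0 zero)) (ℕP.+-identityʳ e)) (+2·-zero ε u (u≡0 ∘ suc))

total-+2· : ∀ {n} (ε u : Vec ℕ n) → total (ε +2· u) ≡ total ε + (total u + total u)
total-+2· ε u = trans (sum-cong-≗ (lookup-+2· ε u))
  (trans (∑-distrib-+ (lookup ε) _) (cong (total ε +_) (∑-distrib-+ (lookup u) (lookup u))))

-- After placing the doubled letters, what remains must be exactly ε.
avoiders-+2· : ∀ {n} (ε u : Vec ℕ n) → avoiders (baseWord ε) (ε +2· u) ≡ P′ ε * isEmpty u
avoiders-+2· ε u with isAnagram? u []
... | yes u≡0 = begin
  avoiders (baseWord ε) (ε +2· u) ≡⟨ cong (avoiders (baseWord ε)) (+2·-zero ε u (sym ∘ u≡0)) ⟩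
  avoiders (baseWord ε) ε         ≡⟨ P′≡avoiders ε ⟨
  P′ ε                            ≡⟨ ℕP.*-identityʳ (P′ ε) ⟨
  P′ ε * 1                        ∎
  where open ≡-Reasoning
... | no u≢0 = trans (avoiders-size (baseWord ε) (ε +2· u) size≢) (sym (ℕP.*-zeroʳ (P′ ε)))
  where
  size≢ : total (ε +2· u) ≢ length (baseWord ε)
  size≢ e = u≢0 (λ k → sym (total≡0 u (ℕP.m+n≡0⇒m≡0 (total u) u+u≡0) k))
    where
    u+u≡0 : total u + total u ≡ 0
    u+u≡0 = ℕP.+-cancelˡ-≡ (total ε) _ _
      (trans (sym (total-+2· ε u)) (trans e (trans (length-baseWord ε) (sym (ℕP.+-identityʳ _)))))

replicate-+ : ∀ {A : Set} a b (x : A) → replicate (a + b) x ≡ replicate a x ++ replicate b x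
replicate-+ zero b x = refl
replicate-+ (suc a) b x = cong (x ∷_) (replicate-+ a b x)

double-replicate : ∀ {A : Set} m (x : A) → double (replicate m x) ≡ replicate (m + m) x
double-replicate zero x = refl
double-replicate (suc m) x =
  trans (cong (λ l → x ∷ x ∷ l) (double-replicate m x)) (cong (λ z → x ∷ replicate z x) (sym (ℕP.+-suc m m)))

double-++ : ∀ {A : Set} (xs ys : List A) → double (xs ++ ys) ≡ double xs ++ double ys
double-++ [] ys = refl
double-++ (x ∷ xs) ys = cong (λ l → x ∷ x ∷ l) (double-++ xs ys)

double-concatMap : ∀ {A B : Set} (f : A → List B) xs → double (concatMap f xs) ≡ concatMap (double ∘ f) xs
double-concatMap f [] = refl
double-concatMap f (x ∷ xs) = trans (double-++ (f x) (concatMap f xs)) (cong (double (f x) ++_) (double-concatMap f xs))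

concatMap-++-↭ : ∀ {A B : Set} (f g : A → List B) xs →
                 concatMap (λ x → f x ++ g x) xs ↭ concatMap f xs ++ concatMap g xs
concatMap-++-↭ f g [] = ↭.refl
concatMap-++-↭ f g (x ∷ xs) =
  ↭-trans (↭P.++⁺ˡ (f x ++ g x) (concatMap-++-↭ f g xs))
  (↭-trans (↭-reflexive (ListP.++-assoc (f x) (g x) _))
  (↭-trans (↭P.++⁺ˡ (f x) (↭P.shifts (g x) (concatMap f xs)))
  (↭-reflexive (sym (ListP.++-assoc (f x) (concatMap f xs) _)))))

baseWord-+2· : ∀ {n} (ε u : Vec ℕ n) → baseWord (ε +2· u) ↭ double (baseWord u) ++ baseWord ε
baseWord-+2· {n} ε u =
  ↭-trans (↭-reflexive (ListP.concatMap-cong split (allFin n)))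
  (↭-trans (concatMap-++-↭ (λ i → replicate (lookup ε i) i) (λ i → double (replicate (lookup u i) i)) (allFin n))
  (↭-trans (↭P.++-comm (baseWord ε) _)
  (↭-reflexive (cong (_++ baseWord ε) (sym (double-concatMap (λ i → replicate (lookup u i) i) (allFin n)))))))
  where
  split : ∀ i → replicate (lookup (ε +2· u) i) i ≡ replicate (lookup ε i) i ++ double (replicate (lookup u i) i)
  split i = begin
    replicate (lookup (ε +2· u) i) i
      ≡⟨ cong (λ z → replicate z i) (lookup-+2· ε u i) ⟩
    replicate (lookup ε i + (lookup u i + lookup u i)) i
      ≡⟨ replicate-+ (lookup ε i) _ i ⟩
    replicate (lookup ε i) i ++ replicate (lookup u i + lookup u i) i
      ≡⟨ cong (replicate (lookup ε i) i ++_) (double-replicate (lookup u i) i) ⟨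
    replicate (lookup ε i) i ++ double (replicate (lookup u i) i) ∎
    where open ≡-Reasoning

-- Reorder the base word, pair up the doubled letters, and separate the two parts.
P′-+2· : ∀ {n} (ε u : Vec ℕ n) → ZeroOne ε → P′ (ε +2· u) ≡₂ P′ ε * P′ u
P′-+2· ε u ε01 = begin
  P′ (ε +2· u)                                                 ≡⟨ P′≡avoiders (ε +2· u) ⟩
  avoiders (baseWord (ε +2· u)) (ε +2· u)                      ≡⟨ fill-↭ (baseWord-+2· ε u) isEmpty (ε +2· u) ⟩
  fill (double (baseWord u) ++ baseWord ε) isEmpty (ε +2· u)   ≈⟨ fill-double (baseWord u) (baseWord ε) isEmpty (ε +2· u) ⟩
  fill₂ (baseWord u) (avoiders (baseWord ε)) (ε +2· u)         ≡⟨ fill₂-+2· ε ε01 (baseWord u) (avoiders (baseWord ε)) u ⟩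
  fill (baseWord u) (avoiders (baseWord ε) ∘ (ε +2·_)) u      ≡⟨ fill-cong (baseWord u) (avoiders-+2· ε) u ⟩
  fill (baseWord u) (λ d → P′ ε * isEmpty d) u                ≡⟨ fill-*ˡ (baseWord u) (P′ ε) isEmpty u ⟩
  P′ ε * avoiders (baseWord u) u                               ≡⟨ cong (P′ ε *_) (P′≡avoiders u) ⟨
  P′ ε * P′ u                                                  ∎
  where open ≡₂-Reasoning

-- Derangement parity: for ε ∈ {0,1}ⁿ, P′(ε) is a derangement number and
-- P′(ε) ≡ |ε| + 1 (mod 2).  Induction on the base word needs the more general
-- count of partial derangements.

occ : ∀ {n} → Fin n → List (Fin n) → ℕ
occ k b = ∑ᴸ b (λ y → 𝟙 (k ≟F y))

Distinct : ∀ {n} → List (Fin n) → Set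
Distinct {n} b = ∀ (k : Fin n) → occ k b ≤ 1

hits : ∀ {n} → List (Fin n) → Vec ℕ n → ℕ
hits b c = ∑ᴸ b (lookup c)

-- D₂ m d is the parity of the number of bijections between two m-element sets
-- with m − d common elements, none of which is fixed: m + 1, 1 or 0 according
-- as d = 0, d = 1 or d ≥ 2.
D₂ : ℕ → ℕ → ℕ
D₂ m zero = suc m
D₂ m (suc zero) = 1
D₂ m (suc (suc _)) = 0

∑-𝟙≡ : ∀ n (y : Fin n) (f : Fin n → ℕ) → ∑[ k < n ] (𝟙 (k ≟F y) * f k) ≡ f y
∑-𝟙≡ (suc n) zero f = trans (cong (f zero + 0 +_) (sum-replicate-zero n)) (trans (ℕP.+-identityʳ _) (ℕP.+-identityʳ _))
∑-𝟙≡ (suc n) (suc y) f =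
  trans (sum-cong-≗ (λ k → cong (_* f (suc k)) (𝟙-⇔ suc-injective (cong suc) (suc k ≟F suc y) (k ≟F y))))
        (∑-𝟙≡ n y (f ∘ suc))

∑-occ : ∀ {n} (b : List (Fin n)) (f : Fin n → ℕ) → ∑[ k < n ] (f k * occ k b) ≡ ∑ᴸ b f
∑-occ {n} b f = begin
  ∑[ k < n ] (f k * ∑ᴸ b (λ y → 𝟙 (k ≟F y)))    ≡⟨ sum-cong-≗ (λ k → sym (∑ᴸ-*ˡ (f k) b _)) ⟩
  ∑[ k < n ] ∑ᴸ b (λ y → f k * 𝟙 (k ≟F y))      ≡⟨ ∑ᴸ-∑-comm b n (λ y k → f k * 𝟙 (k ≟F y)) ⟨
  ∑ᴸ b (λ y → ∑[ k < n ] (f k * 𝟙 (k ≟F y)))    ≡⟨ ∑ᴸ-cong b (λ y → trans (sum-cong-≗ (λ k → ℕP.*-comm (f k) _)) (∑-𝟙≡ n y f)) ⟩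
  ∑ᴸ b f                                         ∎
  where open ≡-Reasoning

∑-others : ∀ {n} (x : Fin n) (c : Vec ℕ n) → ∑[ k < n ] (𝟙[ k ≢ x ] * lookup c k) + lookup c x ≡ total c
∑-others {n} x c = begin
  ∑[ k < n ] (𝟙[ k ≢ x ] * lookup c k) + lookup c x
    ≡⟨ cong (∑[ k < n ] (𝟙[ k ≢ x ] * lookup c k) +_) (∑-𝟙≡ n x (lookup c)) ⟨
  ∑[ k < n ] (𝟙[ k ≢ x ] * lookup c k) + ∑[ k < n ] (𝟙 (k ≟F x) * lookup c k)
    ≡⟨ ∑-distrib-+ (λ k → 𝟙[ k ≢ x ] * lookup c k) _ ⟨
  ∑[ k < n ] (𝟙[ k ≢ x ] * lookup c k + 𝟙 (k ≟F x) * lookup c k)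
    ≡⟨ sum-cong-≗ (λ k → trans (sym (ℕP.*-distribʳ-+ (lookup c k) 𝟙[ k ≢ x ] _))
                          (trans (cong (_* lookup c k) (𝟙≢+𝟙≡ k x)) (ℕP.*-identityˡ _))) ⟩
  total c ∎
  where open ≡-Reasoning

∑-others-occ : ∀ {n} (x : Fin n) b (c : Vec ℕ n) → occ x b ≡ 0 →
               ∑[ k < n ] (𝟙[ k ≢ x ] * (lookup c k * occ k b)) ≡ hits b c
∑-others-occ {n} x b c x∉b = trans (sum-cong-≗ term) (∑-occ b (lookup c))
  where
  term : ∀ k → 𝟙[ k ≢ x ] * (lookup c k * occ k b) ≡ lookup c k * occ k b
  term k with k ≟F x
  ... | yes refl = sym (trans (cong (lookup c k *_) x∉b) (ℕP.*-zeroʳ (lookup c k)))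
  ... | no _ = ℕP.+-identityʳ _

∑-others-split : ∀ {n} (x : Fin n) b (c : Vec ℕ n) → Distinct b →
  ∑[ k < n ] (𝟙[ k ≢ x ] * (lookup c k * occ k b)) + ∑[ k < n ] (𝟙[ k ≢ x ] * (lookup c k * (1 ∸ occ k b)))
    ≡ ∑[ k < n ] (𝟙[ k ≢ x ] * lookup c k)
∑-others-split {n} x b c distinct =
  trans (sym (∑-distrib-+ (λ k → 𝟙[ k ≢ x ] * (lookup c k * occ k b)) (λ k → 𝟙[ k ≢ x ] * (lookup c k * (1 ∸ occ k b)))))
        (sum-cong-≗ term)
  where
  term : ∀ k → 𝟙[ k ≢ x ] * (lookup c k * occ k b) + 𝟙[ k ≢ x ] * (lookup c k * (1 ∸ occ k b)) ≡ 𝟙[ k ≢ x ] * lookup c k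
  term k = begin
    𝟙[ k ≢ x ] * (lookup c k * occ k b) + 𝟙[ k ≢ x ] * (lookup c k * (1 ∸ occ k b))
      ≡⟨ ℕP.*-distribˡ-+ 𝟙[ k ≢ x ] _ _ ⟨
    𝟙[ k ≢ x ] * (lookup c k * occ k b + lookup c k * (1 ∸ occ k b))
      ≡⟨ cong (𝟙[ k ≢ x ] *_) (ℕP.*-distribˡ-+ (lookup c k) (occ k b) _) ⟨
    𝟙[ k ≢ x ] * (lookup c k * (occ k b + (1 ∸ occ k b)))
      ≡⟨ cong (λ z → 𝟙[ k ≢ x ] * (lookup c k * z)) (ℕP.m+[n∸m]≡n (distinct k)) ⟩
    𝟙[ k ≢ x ] * (lookup c k * 1)
      ≡⟨ cong (𝟙[ k ≢ x ] *_) (ℕP.*-identityʳ (lookup c k)) ⟩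
    𝟙[ k ≢ x ] * lookup c k ∎
    where open ≡-Reasoning

hits-remove : ∀ {n} b (c : Vec ℕ n) k m → lookup c k ≡ suc m → hits b (c -₁ k) + occ k b ≡ hits b c
hits-remove b c k m ck = trans (sym (∑ᴸ-+ b _ _)) (∑ᴸ-cong b per-letter)
  where
  per-letter : ∀ y → lookup (c -₁ k) y + 𝟙 (k ≟F y) ≡ lookup c y
  per-letter y with k ≟F y
  ... | yes refl = trans (cong (_+ 1) (trans (lookup∘updateAt k c) (cong pred ck))) (trans (ℕP.+-comm m 1) (sym ck))
  ... | no k≢y = trans (ℕP.+-identityʳ _) (lookup∘updateAt′ y k (k≢y ∘ sym) c)

hits≤length : ∀ {n} b (c : Vec ℕ n) → ZeroOne c → hits b c ≤ length b
hits≤length [] c c01 = z≤n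
hits≤length (x ∷ b) c c01 = ℕP.+-mono-≤ (c01 x) (hits≤length b c c01)

ZeroOne-remove : ∀ {n} (c : Vec ℕ n) k → ZeroOne c → ZeroOne (c -₁ k)
ZeroOne-remove c k c01 i with i ≟F k
... | yes refl = ℕP.≤-trans (ℕP.≤-reflexive (lookup∘updateAt i c)) (ℕP.≤-trans ℕP.pred[n]≤n (c01 i))
... | no i≢k = ℕP.≤-trans (ℕP.≤-reflexive (lookup∘updateAt′ i k i≢k c)) (c01 i)

D₂-split : ∀ m d o → o ≤ 1 → D₂ m (d + o) ≡ o * D₂ m (suc d) + (1 ∸ o) * D₂ m d
D₂-split m d zero _ = trans (cong (D₂ m) (ℕP.+-identityʳ d)) (sym (ℕP.+-identityʳ _))
D₂-split m d (suc zero) _ = trans (cong (D₂ m) (ℕP.+-comm d 1)) (sym (trans (ℕP.+-identityʳ _) (ℕP.+-identityʳ _)))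
D₂-split m d (suc (suc _)) (s≤s ())

-- The recursion for partial derangements, modulo 2: the first position is
-- matched to one of the j letters shared with the rest (leaving d′ + 1 unmatched
-- letters) or to one of the d letters not shared (leaving d′); cx ∈ {0,1}
-- records whether the first base letter itself is available.
D₂-step : ∀ j d′ d cx → cx ≤ 1 → cx + d ≡ suc d′ →
          D₂ (j + d′) (suc d′) * j + D₂ (j + d′) d′ * d ≡₂ D₂ (suc (j + d′)) d
D₂-step j zero .1 zero _ refl = begin
  1 * j + suc (j + 0) * 1  ≡⟨ solve 1 (λ j → con 1 :* j :+ (con 1 :+ (j :+ con 0)) :* con 1 := j :+ j :+ con 1) refl j ⟩
  j + j + 1                ≈⟨ ≡₂-double j 1 ⟩
  1                        ∎
  where open ≡₂-Reasoning
D₂-step j (suc zero) .2 zero _ refl = ≡₂-double 1 0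
D₂-step j (suc (suc d′)) ._ zero _ refl = ≡₂-refl
D₂-step j zero .0 (suc zero) _ refl = begin
  1 * j + suc (j + 0) * 0  ≡⟨ solve 1 (λ j → con 1 :* j :+ (con 1 :+ (j :+ con 0)) :* con 0 := j) refl j ⟩
  j                        ≈⟨ ≡₂-double 1 j ⟨
  1 + 1 + j                ≡⟨ solve 1 (λ j → con 1 :+ con 1 :+ j := con 2 :+ (j :+ con 0)) refl j ⟩
  suc (suc (j + 0))        ∎
  where open ≡₂-Reasoning
D₂-step j (suc zero) .1 (suc zero) _ refl = ≡₂-refl
D₂-step j (suc (suc d′)) ._ (suc zero) _ refl = ≡₂-refl
D₂-step j d′ d (suc (suc _)) (s≤s ()) _

Distinct-tail : ∀ {n} (x : Fin n) b → Distinct (x ∷ b) → Distinct b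
Distinct-tail x b distinct k = ℕP.≤-trans (ℕP.m≤n+m (occ k b) _) (distinct k)

Distinct-head : ∀ {n} (x : Fin n) b → Distinct (x ∷ b) → occ x b ≡ 0
Distinct-head x b distinct with x ≟F x | distinct x
... | yes _ | s≤s o≤0 = ℕP.n≤0⇒n≡0 o≤0
... | no x≢x | _ = ⊥-elim (x≢x refl)

-- Placing the first letter: weighing each available k ≢ x by P if it is shared
-- with the rest of b and by Q otherwise gives P · hits b c + Q · d, where d
-- counts the unmatched positions of x ∷ b.
first-position : ∀ {n} (x : Fin n) b (c : Vec ℕ n) → Distinct (x ∷ b) → ∀ d →
  total c ≡ suc (length b) → hits (x ∷ b) c + d ≡ suc (length b) → ∀ P Q →
  ∑[ k < n ] (𝟙[ k ≢ x ] * (lookup c k * (occ k b * P + (1 ∸ occ k b) * Q))) ≡ P * hits b c + Q * d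
first-position {n} x b c distinct d size unmatched P Q = begin
  ∑[ k < n ] (𝟙[ k ≢ x ] * (lookup c k * (occ k b * P + (1 ∸ occ k b) * Q)))
    ≡⟨ sum-cong-≗ (λ k → expand 𝟙[ k ≢ x ] (lookup c k) (occ k b) (1 ∸ occ k b)) ⟩
  ∑[ k < n ] (P * sharedTerm k + Q * unsharedTerm k)
    ≡⟨ ∑-distrib-+ (λ k → P * sharedTerm k) (λ k → Q * unsharedTerm k) ⟩
  ∑[ k < n ] (P * sharedTerm k) + ∑[ k < n ] (Q * unsharedTerm k)
    ≡⟨ cong₂ _+_ (sym (*-distribˡ-sum P sharedTerm)) (sym (*-distribˡ-sum Q unsharedTerm)) ⟩
  P * shared + Q * unshared
    ≡⟨ cong₂ (λ a e → P * a + Q * e) shared≡ unshared≡ ⟩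
  P * hits b c + Q * d ∎
  where
  open ≡-Reasoning
  sharedTerm unsharedTerm : Fin n → ℕ
  sharedTerm k = 𝟙[ k ≢ x ] * (lookup c k * occ k b)
  unsharedTerm k = 𝟙[ k ≢ x ] * (lookup c k * (1 ∸ occ k b))
  shared = ∑[ k < n ] sharedTerm k
  unshared = ∑[ k < n ] unsharedTerm k
  shared≡ : shared ≡ hits b c
  shared≡ = ∑-others-occ x b c (Distinct-head x b distinct)
  -- the letters of c other than x split into shared + unshared; comparing sizes gives unshared = d
  unshared≡ : unshared ≡ d
  unshared≡ = ℕP.+-cancelˡ-≡ (lookup c x + hits b c) unshared d (begin
    lookup c x + hits b c + unshared  ≡⟨ cong (λ z → lookup c x + z + unshared) shared≡ ⟨
    lookup c x + shared + unshared    ≡⟨ solve 3 (λ a s u → a :+ s :+ u := s :+ u :+ a) refl (lookup c x) shared unshared ⟩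
    shared + unshared + lookup c x    ≡⟨ cong (_+ lookup c x) (∑-others-split x b c (Distinct-tail x b distinct)) ⟩
    ∑[ k < n ] (𝟙[ k ≢ x ] * lookup c k) + lookup c x ≡⟨ ∑-others x c ⟩
    total c                           ≡⟨ trans size (sym unmatched) ⟩
    lookup c x + hits b c + d         ∎)
  expand : ∀ u ck o r → u * (ck * (o * P + r * Q)) ≡ P * (u * (ck * o)) + Q * (u * (ck * r))
  expand u ck o r = solve 6
    (λ u ck o r p q → u :* (ck :* (o :* p :+ r :* q)) := p :* (u :* (ck :* o)) :+ q :* (u :* (ck :* r)))
    refl u ck o r P Q

-- Avoiding a word b without repeated letters with a 0/1 multiset c of the same
-- size, where d positions of b carry letters absent from c.
avoiders-01 : ∀ {n} (b : List (Fin n)) (c : Vec ℕ n) → ZeroOne c → Distinct b → total c ≡ length b →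
              ∀ d → hits b c + d ≡ length b → avoiders b c ≡₂ D₂ (length b) d
avoiders-01 [] c c01 distinct size d refl with isAnagram? c []
... | yes _ = ≡₂-refl
... | no c≢0 = ⊥-elim (c≢0 (λ k → sym (total≡0 c size k)))
avoiders-01 {n} (x ∷ b) c c01 distinct size d unmatched = begin
  avoiders (x ∷ b) c
    ≈⟨ ≡₂-∑ n term ⟩
  ∑[ k < n ] (𝟙[ k ≢ x ] * (lookup c k * (occ k b * P + (1 ∸ occ k b) * Q)))
    ≡⟨ first-position x b c distinct d size unmatched P Q ⟩
  P * j + Q * d
    ≡⟨ cong₂ (λ a e → a * j + e * d) (cong (λ z → D₂ z (suc d′)) (sym j+d′)) (cong (λ z → D₂ z d′) (sym j+d′)) ⟩
  D₂ (j + d′) (suc d′) * j + D₂ (j + d′) d′ * d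
    ≈⟨ D₂-step j d′ d (lookup c x) (c01 x) cx+d ⟩
  D₂ (suc (j + d′)) d
    ≡⟨ cong (λ z → D₂ (suc z) d) j+d′ ⟩
  D₂ (suc (length b)) d ∎
  where
  open ≡₂-Reasoning
  j = hits b c
  d′ = length b ∸ j
  j+d′ : j + d′ ≡ length b
  j+d′ = ℕP.m+[n∸m]≡n (hits≤length b c c01)
  P = D₂ (length b) (suc d′)
  Q = D₂ (length b) d′
  cx+d : lookup c x + d ≡ suc d′
  cx+d = ℕP.+-cancelˡ-≡ j _ _ (trans (solve 3 (λ j a d → j :+ (a :+ d) := a :+ j :+ d) refl j (lookup c x) d)
    (trans unmatched (trans (cong suc (sym j+d′)) (sym (ℕP.+-suc j d′)))))

  -- Removing an available letter k leaves d′ + occ k b unmatched positions.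
  term : ∀ k → 𝟙[ k ≢ x ] * (𝟙[ lookup c k ≥1] * avoiders b (c -₁ k))
            ≡₂ 𝟙[ k ≢ x ] * (lookup c k * (occ k b * P + (1 ∸ occ k b) * Q))
  term k with lookup c k in ck | c01 k
  ... | zero | _ = ≡₂-refl
  ... | suc zero | _ = ≡₂-*ˡ 𝟙[ k ≢ x ] (≡₂-*ˡ 1 (≡₂-trans
          (avoiders-01 b (c -₁ k) (ZeroOne-remove c k c01) (Distinct-tail x b distinct) size′ (d′ + occ k b) unmatched′)
          (≡⇒≡₂ (D₂-split (length b) d′ (occ k b) (Distinct-tail x b distinct k)))))
    where
    size′ : total (c -₁ k) ≡ length b
    size′ = ℕP.suc-injective (trans (sym (total-remove c k 0 ck)) size)
    unmatched′ : hits b (c -₁ k) + (d′ + occ k b) ≡ length b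
    unmatched′ = trans (solve 3 (λ h d o → h :+ (d :+ o) := h :+ o :+ d) refl (hits b (c -₁ k)) d′ (occ k b))
                       (trans (cong (_+ d′) (hits-remove b c k 0 ck)) j+d′)
  ... | suc (suc _) | s≤s ()

∑ᴸ-baseWord : ∀ {n} (ε : Vec ℕ n) (f : Fin n → ℕ) → ∑ᴸ (baseWord ε) f ≡ ∑[ i < n ] (lookup ε i * f i)
∑ᴸ-baseWord {n} ε f =
  trans (∑ᴸ-concatMap _ (allFin n) f) (trans (∑ᴸ-allFin n _) (sum-cong-≗ (λ i → ∑ᴸ-replicate (lookup ε i) i f)))

occ-baseWord : ∀ {n} (ε : Vec ℕ n) k → occ k (baseWord ε) ≡ lookup ε k
occ-baseWord {n} ε k = trans (∑ᴸ-baseWord ε _)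
  (trans (sum-cong-≗ (λ i → trans (ℕP.*-comm (lookup ε i) _) (cong (_* lookup ε i) (𝟙-⇔ sym sym (k ≟F i) (i ≟F k)))))
         (∑-𝟙≡ n k (lookup ε)))

square-01 : ∀ e → e ≤ 1 → e * e ≡ e
square-01 zero _ = refl
square-01 (suc zero) _ = refl
square-01 (suc (suc e)) (s≤s ())

P′-01 : ∀ {n} (ε : Vec ℕ n) → ZeroOne ε → P′ ε ≡₂ suc (total ε)
P′-01 {n} ε ε01 = begin
  P′ ε                        ≡⟨ P′≡avoiders ε ⟩
  avoiders (baseWord ε) ε     ≈⟨ avoiders-01 (baseWord ε) ε ε01 distinct (sym len) 0 all-hit ⟩
  D₂ (length (baseWord ε)) 0  ≡⟨ cong suc len ⟩
  suc (total ε)               ∎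
  where
  open ≡₂-Reasoning
  len = length-baseWord ε
  distinct : Distinct (baseWord ε)
  distinct k = subst (_≤ 1) (sym (occ-baseWord ε k)) (ε01 k)
  all-hit : hits (baseWord ε) ε + 0 ≡ length (baseWord ε)
  all-hit = trans (ℕP.+-identityʳ _)
    (trans (∑ᴸ-baseWord ε (lookup ε)) (trans (sum-cong-≗ (λ i → square-01 (lookup ε i) (ε01 i))) (sym len)))

lowBits highBits : ∀ {n} → Vec ℕ n → Vec ℕ n
lowBits t = Vec.map (_% 2) t
highBits t = Vec.map (_/ 2) t

%2≤1 : ∀ a → a % 2 ≤ 1
%2≤1 a = ℕP.≤-pred (m%n<n a 2)

bits-split : ∀ {n} (t : Vec ℕ n) → t ≡ lowBits t +2· highBits t
bits-split [] = refl
bits-split (x ∷ t) = cong₂ _∷_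
  (trans (m≡m%n+[m/n]*n x 2) (cong (x % 2 +_) (solve 1 (λ y → y :* con 2 := y :+ y) refl (x / 2))))
  (bits-split t)

lowBits-01 : ∀ {n} (t : Vec ℕ n) → ZeroOne (lowBits t)
lowBits-01 t k = subst (_≤ 1) (sym (lookup-map k (_% 2) t)) (%2≤1 (lookup t k))

P′-halving : ∀ {n} (t : Vec ℕ n) → P′ t ≡₂ suc (total (lowBits t)) * P′ (highBits t)
P′-halving t = begin
  P′ t                                  ≡⟨ cong P′ (bits-split t) ⟩
  P′ (lowBits t +2· highBits t)         ≈⟨ P′-+2· (lowBits t) (highBits t) (lowBits-01 t) ⟩
  P′ (lowBits t) * P′ (highBits t)      ≈⟨ ≡⇒≡₂ (ℕP.*-comm (P′ (lowBits t)) _) ⟩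
  P′ (highBits t) * P′ (lowBits t)      ≈⟨ ≡₂-*ˡ (P′ (highBits t)) (P′-01 (lowBits t) (lowBits-01 t)) ⟩
  P′ (highBits t) * suc (total (lowBits t))  ≡⟨ ℕP.*-comm (P′ (highBits t)) _ ⟩
  suc (total (lowBits t)) * P′ (highBits t)  ∎
  where open ≡₂-Reasoning

𝟙≟1 : ∀ v → v ≤ 1 → 𝟙 (v ℕP.≟ 1) ≡ v
𝟙≟1 zero _ = refl
𝟙≟1 (suc zero) _ = refl
𝟙≟1 (suc (suc v)) (s≤s ())

bitCount-zero : ∀ {n} (t : Vec ℕ n) → bitCount t 0 ≡ total (lowBits t)
bitCount-zero {n} t = trans (length-filter _ (allFin n)) (trans (∑ᴸ-allFin n _)
  (sum-cong-≗ (λ i → trans (𝟙≟1 (lookup t i % 2) (%2≤1 (lookup t i))) (sym (lookup-map i (_% 2) t)))))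

bitCount-suc : ∀ {n} (t : Vec ℕ n) x → bitCount t (suc x) ≡ bitCount (highBits t) x
bitCount-suc {n} t x = trans (length-filter _ (allFin n))
  (trans (∑ᴸ-cong (allFin n) digit) (sym (length-filter _ (allFin n))))
  where
  digit : ∀ i → 𝟙 (bit (lookup t i) (suc x) ℕP.≟ 1) ≡ 𝟙 (bit (lookup (highBits t) i) x ℕP.≟ 1)
  digit i = 𝟙-⇔ (subst (λ z → bit z x ≡ 1) (sym (lookup-map i (_/ 2) t)))
                (subst (λ z → bit z x ≡ 1) (lookup-map i (_/ 2) t)) _ _

bit-0 : ∀ x → bit 0 x ≡ 0
bit-0 zero = refl
bit-0 (suc x) = bit-0 x

bitCount-empty : ∀ {n} (t : Vec ℕ n) → total t ≡ 0 → ∀ x → bitCount t x ≡ 0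
bitCount-empty {n} t t≡0 x = trans (length-filter _ (allFin n)) (trans (∑ᴸ-allFin n _)
  (trans (sum-cong-≗ (λ i → 𝟙-no (unset i) _)) (sum-replicate-zero n)))
  where
  unset : ∀ i → bit (lookup t i) x ≢ 1
  unset i set with trans (sym (bit-0 x)) (trans (cong (λ v → bit v x) (sym (total≡0 t t≡0 i))) set)
  ... | ()

half-smaller : ∀ e v → e + (v + v) ≢ 0 → suc v ≤ e + (v + v)
half-smaller zero zero nonzero = ⊥-elim (nonzero refl)
half-smaller (suc e) zero nonzero = s≤s z≤n
half-smaller e (suc v) nonzero = ℕP.≤-trans (s≤s (ℕP.m≤n+m (suc v) v)) (ℕP.m≤n+m (suc v + suc v) e)

≡⇒⇔ : ∀ {A B : Set} → A ≡ B → A ⇔ B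
≡⇒⇔ refl = mk⇔ (λ a → a) (λ a → a)

odd-*-digits : ∀ p q → p ≤ 1 → q ≤ 1 → ((p * q) % 2 ≡ 1) ⇔ (p ≡ 1 × q ≡ 1)
odd-*-digits zero q _ _ = mk⇔ (λ ()) (λ ())
odd-*-digits (suc zero) zero _ _ = mk⇔ (λ ()) (λ ())
odd-*-digits (suc zero) (suc zero) _ _ = mk⇔ (λ _ → refl , refl) (λ _ → refl)
odd-*-digits (suc zero) (suc (suc _)) _ (s≤s ())
odd-*-digits (suc (suc _)) q (s≤s ()) _

odd-* : ∀ a b → ((a * b) % 2 ≡ 1) ⇔ (a % 2 ≡ 1 × b % 2 ≡ 1)
odd-* a b = ⇔-trans (≡⇒⇔ (cong (_≡ 1) (%-distribˡ-* a b 2))) (odd-*-digits (a % 2) (b % 2) (%2≤1 a) (%2≤1 b))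

odd-suc-digit : ∀ p → p ≤ 1 → ((1 + p) % 2 ≡ 1) ⇔ (p ≡ 0)
odd-suc-digit zero _ = mk⇔ (λ _ → refl) (λ _ → refl)
odd-suc-digit (suc zero) _ = mk⇔ (λ ()) (λ ())
odd-suc-digit (suc (suc _)) (s≤s ())

odd-suc : ∀ a → (suc a % 2 ≡ 1) ⇔ (a % 2 ≡ 0)
odd-suc a = ⇔-trans (≡⇒⇔ (cong (_≡ 1) (%-distribˡ-+ 1 a 2))) (odd-suc-digit (a % 2) (%2≤1 a))

≡₂-odd : ∀ {a b} → a ≡₂ b → (a % 2 ≡ 1) ⇔ (b % 2 ≡ 1)
≡₂-odd (mod2 p) = mk⇔ (trans (sym p)) (trans p)

∀-⇔ : ∀ {P Q : ℕ → Set} → (∀ x → P x ⇔ Q x) → (∀ x → P x) ⇔ (∀ x → Q x)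
∀-⇔ e = mk⇔ (λ p x → Equivalence.to (e x) (p x)) (λ q x → Equivalence.from (e x) (q x))

∀ℕ-split : ∀ {P : ℕ → Set} → (∀ x → P x) ⇔ (P 0 × ∀ x → P (suc x))
∀ℕ-split = mk⇔ (λ p → p 0 , p ∘ suc) (λ { (p0 , ps) zero → p0 ; (p0 , ps) (suc x) → ps x })

-- The criterion, by induction on the size |t|: the last binary digits are
-- handled by P′-halving, the remaining digits by induction on ⌊t/2⌋.
parity-criterion : ∀ fuel {n} (t : Vec ℕ n) → total t ≤ fuel →
                   (P′ t % 2 ≡ 1) ⇔ (∀ x → bitCount t x % 2 ≡ 0)
parity-criterion fuel t bound with total t ℕP.≟ 0
... | yes t≡0 = mk⇔ (λ _ x → cong (_% 2) (bitCount-empty t t≡0 x))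
                    (λ _ → trans (mod2-eq (P′-01 t empty-01)) (cong (λ s → suc s % 2) t≡0))
  where
  empty-01 : ZeroOne t
  empty-01 k = subst (_≤ 1) (sym (total≡0 t t≡0 k)) z≤n
parity-criterion zero t bound | no t≢0 = ⊥-elim (t≢0 (ℕP.n≤0⇒n≡0 bound))
parity-criterion (suc fuel) t bound | no t≢0 = begin
  P′ t % 2 ≡ 1
    ≈⟨ ≡₂-odd (P′-halving t) ⟩
  (suc (total ε) * P′ u) % 2 ≡ 1
    ≈⟨ odd-* (suc (total ε)) (P′ u) ⟩
  ((suc (total ε) % 2 ≡ 1) × (P′ u % 2 ≡ 1))
    ≈⟨ (odd-suc (total ε) ×-⇔ parity-criterion fuel u smaller) ⟩
  ((total ε % 2 ≡ 0) × (∀ x → bitCount u x % 2 ≡ 0))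
    ≈⟨ (≡⇒⇔ (cong (λ z → z % 2 ≡ 0) (sym (bitCount-zero t)))
       ×-⇔ ∀-⇔ (λ x → ≡⇒⇔ (cong (λ z → z % 2 ≡ 0) (sym (bitCount-suc t x))))) ⟩
  ((bitCount t 0 % 2 ≡ 0) × (∀ x → bitCount t (suc x) % 2 ≡ 0))
    ≈⟨ ∀ℕ-split ⟨
  (∀ x → bitCount t x % 2 ≡ 0) ∎
  where
  open SetoidReasoning (⇔-setoid 0ℓ)
  ε = lowBits t
  u = highBits t
  size-split : total t ≡ total ε + (total u + total u)
  size-split = trans (cong total (bits-split t)) (total-+2· ε u)
  smaller : total u ≤ fuel
  smaller = ℕP.≤-pred (ℕP.≤-trans (half-smaller (total ε) (total u) (t≢0 ∘ trans size-split))
                                  (ℕP.≤-trans (ℕP.≤-reflexive (sym size-split)) bound))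

theorem5p2 : (n : ℕ) → 1 ≤ n → (t : Vec ℕ n) →
    (P′ t % 2 ≡ 1) ⇔ (∀ (x : ℕ) → bitCount t x % 2 ≡ 0)
theorem5p2 n _ t = parity-criterion (total t) t ℕP.≤-refl
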